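{- Let $k\ge1$ be an integer. If $G$ is a finite simple graph of order $n$ with complement $\overline{G}$, then $$d_R^k(G)+d_R^k(\overline{G})\le n+4k-2,$$ with equality only for graphs with $\Delta(G)-\delta(G)=1$.
   Context: $\Delta(G)$ and $\delta(G)$ denote the maximum and minimum degree of $G$. Let $k\ge1$ be an integer. A Roman $k$-dominating function (RkDF) on a graph $G$ is a map $f:V(G)\to\{0,1,2\}$ such that every vertex $v$ with $f(v)=0$ has at least $k$ neighbors $u$ with $f(u)=2$. A set $\{f_1,\ldots,f_d\}$ of pairwise distinct RkDFs on $G$ with $\sum_{i=1}^d f_i(v)\le 2k$ for every $v\in V(G)$ is a Roman $(k,k)$-dominating family on $G$; the maximum number of functions in such a family is the Roman $(k,k)$-domatic number $d_R^k(G)$. -}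

module Defs where

open import Data.Nat using (ℕ; zero; suc; _+_; _≤_; _⊔_; _⊓_)
open import Data.Bool using (Bool; true; false; not; _∧_; T)
open import Data.Fin using (Fin; _≟_)
open import Data.List using (List; length; map; filterᵇ; foldr)
open import Data.Nat.ListAction using (sum)
open import Data.List.Relation.Unary.AllPairs using (AllPairs)
open import Data.List.Relation.Unary.All using (All)
open import Data.Product using (_×_; Σ)
open import Relation.Nullary using (¬_; Dec; yes; no)
open import Relation.Nullary.Decidable using (⌊_⌋)
open import Relation.Binary.PropositionalEquality using (_≡_)
open import Data.List using (allFin) public

record Graph (n : ℕ) : Set where
  field
    adj    : Fin n → Fin n → Bool
    sym    : ∀ u v → adj u v ≡ adj v u
    irrefl : ∀ v → adj v v ≡ false
open Graph public

complement : ∀ {n} → Graph n → Graph n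
complement {n} G = record { adj = cadj ; sym = csym ; irrefl = cirr }
  where
  cadj : Fin n → Fin n → Bool
  cadj u v = not (adj G u v) ∧ not ⌊ u ≟ v ⌋
  csym : ∀ u v → cadj u v ≡ cadj v u
  csym u v with adj G u v | adj G v u | Graph.sym G u v | u ≟ v | v ≟ u
  ... | a | .a | Relation.Binary.PropositionalEquality.refl | yes p | yes q = Relation.Binary.PropositionalEquality.refl
  ... | a | .a | Relation.Binary.PropositionalEquality.refl | no p | no q = Relation.Binary.PropositionalEquality.refl
  ... | a | .a | Relation.Binary.PropositionalEquality.refl | yes p | no q =
        Data.Empty.⊥-elim (q (Relation.Binary.PropositionalEquality.sym p))
    where import Data.Empty
  ... | a | .a | Relation.Binary.PropositionalEquality.refl | no p | yes q =
        Data.Empty.⊥-elim (p (Relation.Binary.PropositionalEquality.sym q))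
    where import Data.Empty
  cirr : ∀ v → cadj v v ≡ false
  cirr v with v ≟ v
  ... | yes _ = Data.Bool.Properties.∧-zeroʳ (not (adj G v v))
    where import Data.Bool.Properties
  ... | no ¬p = Data.Empty.⊥-elim (¬p Relation.Binary.PropositionalEquality.refl)
    where import Data.Empty

degree : ∀ {n} → Graph n → Fin n → ℕ
degree {n} G v = length (filterᵇ (adj G v) (allFin n))

maxDegree : ∀ {n} → Graph n → ℕ
maxDegree {n} G = foldr _⊔_ 0 (map (degree G) (allFin n))

-- minimum degree δ(G); the seed n is never attained since every degree is ≤ n - 1
-- (for n ≥ 1, which the theorem assumes)
minDegree : ∀ {n} → Graph n → ℕ
minDegree {n} G = foldr _⊓_ n (map (degree G) (allFin n))

Labeling : ℕ → Set
Labeling n = Σ (Fin n → ℕ) (λ f → ∀ v → f v ≤ 2)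

lab : ∀ {n} → Labeling n → Fin n → ℕ
lab = Data.Product.proj₁
  where import Data.Product

is2 : ℕ → Bool
is2 2 = true
is2 _ = false

twoNeighbours : ∀ {n} → Graph n → (Fin n → ℕ) → Fin n → ℕ
twoNeighbours {n} G f v = length (filterᵇ (λ u → adj G v u ∧ is2 (f u)) (allFin n))

IsRkDF : ∀ {n} → ℕ → Graph n → Labeling n → Set
IsRkDF k G f = ∀ v → lab f v ≡ 0 → k ≤ twoNeighbours G (lab f) v

Distinct : ∀ {n} → Labeling n → Labeling n → Set
Distinct f g = ¬ (∀ v → lab f v ≡ lab g v)

IsRkkFamily : ∀ {n} → ℕ → Graph n → List (Labeling n) → Set
IsRkkFamily k G fs =
  AllPairs Distinct fs ×
  All (IsRkDF k G) fs ×
  (∀ v → sum (map (λ f → lab f v) fs) ≤ 2 Data.Nat.* k)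
  where import Data.Nat

IsRomanKKDomaticNumber : ∀ {n} → ℕ → Graph n → ℕ → Set
IsRomanKKDomaticNumber k G d =
  Σ (List (Labeling _)) (λ fs → IsRkkFamily k G fs × length fs ≡ d) ×
  (∀ fs → IsRkkFamily k G fs → length fs ≤ d)

module Submission where

-- The key fact is a counting bound at any vertex v for a Roman (k,k)-dominating
-- family fs:  |fs| + #{f : f(v) = 2} ≤ deg(v) + 2k  (family-bound). Each f contributes
-- at least 1 + [f(v) = 2] to [f(v) = 0] + f(v); the functions vanishing at v number at
-- most deg(v), because each needs weight 2k on N(v) while the family as a whole puts
-- at most 2k on every vertex (a double count); and Σ_f f(v) ≤ 2k.
-- Hence d_R^k(G) ≤ δ(G) + 2k and d_R^k(Ḡ) ≤ δ(Ḡ) + 2k = n - 1 - Δ(G) + 2k, which sum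
-- to n + 4k - 1 - (Δ - δ). When Δ = δ both graphs are regular, and a family reaching
-- the bound would have no label 2 at all, so all its functions would be the constant
-- 1 — impossible for two distinct functions; this makes both bounds strict.

open import Defs
open import Data.Nat using (ℕ; _+_; _*_; _∸_; _≤_)
open import Data.Product using (_×_)
open import Relation.Binary.PropositionalEquality using (_≡_)

open import Data.Nat using (zero; suc; z≤n; s≤s; _<_; _⊔_; _⊓_)
open import Data.Nat.Properties
open import Data.Nat.ListAction using (sum)
open import Data.Nat.Tactic.RingSolver using (solve-∀)
open import Data.Bool using (Bool; true; false; _∧_)
open import Data.Bool.Properties using (∧-zeroʳ)
open import Data.Fin using (Fin)
import Data.Fin as Fin
open import Data.List using (List; []; _∷_; length; map; filterᵇ; foldr)
open import Data.List.Properties using (map-cong; length-tabulate; foldr-preservesᵒ)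
open import Data.List.Relation.Unary.All as All using (All; []; _∷_)
import Data.List.Relation.Unary.Any as Any
open import Data.List.Relation.Unary.AllPairs using (AllPairs; []; _∷_)
open import Data.List.Relation.Unary.Unique.Propositional using (Unique)
open import Data.List.Relation.Unary.Unique.Propositional.Properties using (allFin⁺)
open import Data.List.Membership.Propositional using (_∈_)
open import Data.List.Membership.Propositional.Properties
  using (∈-allFin; ∈-map⁺; ∈-map⁻; foldr-selective)
open import Data.Product using (∃; _,_; proj₁; proj₂)
open import Data.Sum using (_⊎_; inj₁; inj₂; [_,_])
open import Data.Empty using (⊥; ⊥-elim)
open import Function using (_∘_)
open import Algebra.Definitions using (Selective)
open import Relation.Binary.Definitions using (DecidableEquality)
open import Relation.Nullary using (yes; no)
open import Relation.Nullary.Decidable using (⌊_⌋; isYes≗does; dec-true; dec-false)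
open import Relation.Binary.PropositionalEquality
  using (_≢_; refl; trans; subst; cong; cong₂; module ≡-Reasoning)
import Relation.Binary.PropositionalEquality as ≡

∑ : {A : Set} → List A → (A → ℕ) → ℕ
∑ xs g = sum (map g xs)

module _ {A : Set} where

  ∑-mono : {g h : A → ℕ} (xs : List A) → All (λ x → g x ≤ h x) xs → ∑ xs g ≤ ∑ xs h
  ∑-mono []       []         = z≤n
  ∑-mono (x ∷ xs) (gh ∷ ghs) = +-mono-≤ gh (∑-mono xs ghs)

  ∑-cong : {g h : A → ℕ} (xs : List A) → (∀ x → g x ≡ h x) → ∑ xs g ≡ ∑ xs h
  ∑-cong xs g≗h = cong sum (map-cong g≗h xs)

  ∑-+ : (g h : A → ℕ) (xs : List A) → ∑ xs (λ x → g x + h x) ≡ ∑ xs g + ∑ xs h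
  ∑-+ g h []       = refl
  ∑-+ g h (x ∷ xs) rewrite ∑-+ g h xs = +-+-swap (g x) (h x) (∑ xs g) (∑ xs h)
    where
    +-+-swap : ∀ a b c d → (a + b) + (c + d) ≡ (a + c) + (b + d)
    +-+-swap = solve-∀

  ∑-*ˡ : (c : ℕ) (g : A → ℕ) (xs : List A) → ∑ xs (λ x → c * g x) ≡ c * ∑ xs g
  ∑-*ˡ c g []       = ≡.sym (*-zeroʳ c)
  ∑-*ˡ c g (x ∷ xs) rewrite ∑-*ˡ c g xs = ≡.sym (*-distribˡ-+ c (g x) (∑ xs g))

  ∑-length : (xs : List A) → ∑ xs (λ _ → 1) ≡ length xs
  ∑-length []       = refl
  ∑-length (x ∷ xs) = cong suc (∑-length xs)

  ∑-zero⁺ : {g : A → ℕ} (xs : List A) → All (λ x → g x ≡ 0) xs → ∑ xs g ≡ 0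
  ∑-zero⁺ []       []          = refl
  ∑-zero⁺ (x ∷ xs) (gx≡0 ∷ gs) rewrite gx≡0 = ∑-zero⁺ xs gs

  ∑-zero⁻ : {g : A → ℕ} (xs : List A) → ∑ xs g ≡ 0 → All (λ x → g x ≡ 0) xs
  ∑-zero⁻     []       _   = []
  ∑-zero⁻ {g} (x ∷ xs) eq0 = m+n≡0⇒m≡0 (g x) eq0 ∷ ∑-zero⁻ xs (m+n≡0⇒n≡0 (g x) eq0)

∑-swap : {A B : Set} (h : A → B → ℕ) (xs : List A) (ys : List B) →
         ∑ xs (λ a → ∑ ys (h a)) ≡ ∑ ys (λ b → ∑ xs (λ a → h a b))
∑-swap h []       ys = ≡.sym (∑-zero⁺ ys (All.universal (λ _ → refl) ys))
∑-swap h (x ∷ xs) ys = trans (cong (∑ ys (h x) +_) (∑-swap h xs ys))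
                             (≡.sym (∑-+ (h x) (λ b → ∑ xs (λ a → h a b)) ys))

𝟙 : Bool → ℕ
𝟙 true  = 1
𝟙 false = 0

length-filterᵇ : {A : Set} (p : A → Bool) (xs : List A) → length (filterᵇ p xs) ≡ ∑ xs (𝟙 ∘ p)
length-filterᵇ p []       = refl
length-filterᵇ p (x ∷ xs) with p x
... | true  = cong suc (length-filterᵇ p xs)
... | false = length-filterᵇ p xs

module _ {A : Set} (_≟_ : DecidableEquality A) where

  ⌊≟⌋-refl : ∀ v → ⌊ v ≟ v ⌋ ≡ true
  ⌊≟⌋-refl v = trans (isYes≗does (v ≟ v)) (dec-true (v ≟ v) refl)

  ⌊≟⌋-≢ : ∀ {v u} → v ≢ u → ⌊ v ≟ u ⌋ ≡ false
  ⌊≟⌋-≢ {v} {u} v≢u = trans (isYes≗does (v ≟ u)) (dec-false (v ≟ u) v≢u)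

  count-absent : ∀ {v} (xs : List A) → All (v ≢_) xs → ∑ xs (λ u → 𝟙 ⌊ v ≟ u ⌋) ≡ 0
  count-absent xs v∉xs = ∑-zero⁺ xs (All.map (cong 𝟙 ∘ ⌊≟⌋-≢) v∉xs)

  count-unique : ∀ {v} {xs : List A} → Unique xs → v ∈ xs → ∑ xs (λ u → 𝟙 ⌊ v ≟ u ⌋) ≡ 1
  count-unique {v} {x ∷ xs} (x∉xs ∷ _) (Any.here refl)
    rewrite ⌊≟⌋-refl v = cong suc (count-absent xs x∉xs)
  count-unique {v} {x ∷ xs} (x∉xs ∷ unique) (Any.there v∈xs)
    rewrite ⌊≟⌋-≢ (λ v≡x → All.lookup x∉xs v∈xs (≡.sym v≡x)) = count-unique unique v∈xs

-- Degrees. Every vertex u ≠ v is adjacent to v in exactly one of G and its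
-- complement, so deg_Ḡ(v) + deg_G(v) + 1 = n.

degree-∑ : ∀ {n} (G : Graph n) v → degree G v ≡ ∑ (allFin n) (λ u → 𝟙 (adj G v u))
degree-∑ {n} G v = length-filterᵇ (adj G v) (allFin n)

module _ {n : ℕ} (G : Graph n) where

  vertex-trichotomy : ∀ v u →
    𝟙 (adj (complement G) v u) + 𝟙 (adj G v u) + 𝟙 ⌊ v Fin.≟ u ⌋ ≡ 1
  vertex-trichotomy v u with v Fin.≟ u
  ... | yes refl rewrite irrefl G v = refl
  ... | no _ with adj G v u
  ...   | true  = refl
  ...   | false = refl

  complement-degree : ∀ v → degree (complement G) v + degree G v + 1 ≡ n
  complement-degree v = begin
    degree Ḡ v + degree G v + 1
      ≡⟨ cong₂ (λ a b → a + b + 1) (degree-∑ Ḡ v) (degree-∑ G v) ⟩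
    ∑ Fₙ (𝟙 ∘ adj Ḡ v) + ∑ Fₙ (𝟙 ∘ adj G v) + 1
      ≡⟨ cong (∑ Fₙ (𝟙 ∘ adj Ḡ v) + ∑ Fₙ (𝟙 ∘ adj G v) +_)
              (≡.sym (count-unique Fin._≟_ (allFin⁺ n) (∈-allFin v))) ⟩
    ∑ Fₙ (𝟙 ∘ adj Ḡ v) + ∑ Fₙ (𝟙 ∘ adj G v) + ∑ Fₙ (λ u → 𝟙 ⌊ v Fin.≟ u ⌋)
      ≡⟨ cong (_+ ∑ Fₙ (λ u → 𝟙 ⌊ v Fin.≟ u ⌋)) (≡.sym (∑-+ (𝟙 ∘ adj Ḡ v) (𝟙 ∘ adj G v) Fₙ)) ⟩
    ∑ Fₙ (λ u → 𝟙 (adj Ḡ v u) + 𝟙 (adj G v u)) + ∑ Fₙ (λ u → 𝟙 ⌊ v Fin.≟ u ⌋)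
      ≡⟨ ≡.sym (∑-+ _ _ Fₙ) ⟩
    ∑ Fₙ (λ u → 𝟙 (adj Ḡ v u) + 𝟙 (adj G v u) + 𝟙 ⌊ v Fin.≟ u ⌋)
      ≡⟨ ∑-cong Fₙ (vertex-trichotomy v) ⟩
    ∑ Fₙ (λ _ → 1)
      ≡⟨ ∑-length Fₙ ⟩
    length Fₙ
      ≡⟨ length-tabulate (λ u → u) ⟩
    n ∎
    where
    open ≡-Reasoning
    Ḡ : Graph n
    Ḡ = complement G
    Fₙ : List (Fin n)
    Fₙ = allFin n

  -- a vertex is adjacent to fewer than n vertices (needed since n seeds the fold for δ)
  degree<n : ∀ v → degree G v < n
  degree<n v = ≤-trans (s≤s (m≤n+m (degree G v) (degree (complement G) v)))
                       (≤-reflexive (trans (+-comm 1 _) (complement-degree v)))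

module _ {A : Set} (g : A → ℕ) where

  ≤-foldr-⊔ : ∀ e {x} {xs : List A} → x ∈ xs → g x ≤ foldr _⊔_ e (map g xs)
  ≤-foldr-⊔ e {x} {xs} x∈xs = foldr-preservesᵒ
    (λ a b → [ m≤n⇒m≤n⊔o b , m≤n⇒m≤o⊔n a ]) e (map g xs)
    (inj₂ (Any.map ≤-reflexive (∈-map⁺ g x∈xs)))

  foldr-⊓-≤ : ∀ e {x} {xs : List A} → x ∈ xs → foldr _⊓_ e (map g xs) ≤ g x
  foldr-⊓-≤ e {x} {xs} x∈xs = foldr-preservesᵒ
    (λ a b → [ m≤n⇒m⊓o≤n b , m≤n⇒o⊓m≤n a ]) e (map g xs)
    (inj₂ (Any.map (≤-reflexive ∘ ≡.sym) (∈-map⁺ g x∈xs)))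

  foldr-attained : {_•_ : ℕ → ℕ → ℕ} → Selective _≡_ _•_ → ∀ e (xs : List A) →
    foldr _•_ e (map g xs) ≡ e ⊎ ∃ λ x → g x ≡ foldr _•_ e (map g xs)
  foldr-attained sel e xs with foldr-selective sel e (map g xs)
  ... | inj₁ fold≡e = inj₁ fold≡e
  ... | inj₂ fold∈gxs with ∈-map⁻ g fold∈gxs
  ...   | x , _ , fold≡gx = inj₂ (x , ≡.sym fold≡gx)

module _ {n : ℕ} (G : Graph n) where

  degree≤max : ∀ v → degree G v ≤ maxDegree G
  degree≤max v = ≤-foldr-⊔ (degree G) 0 (∈-allFin v)

  min≤degree : ∀ v → minDegree G ≤ degree G v
  min≤degree v = foldr-⊓-≤ (degree G) n (∈-allFin v)

maxDegree-attained : ∀ {m} (G : Graph (suc m)) → ∃ λ v → degree G v ≡ maxDegree G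
maxDegree-attained {m} G with foldr-attained (degree G) ⊔-sel 0 (allFin (suc m))
... | inj₂ attained = attained
... | inj₁ max≡0 = Fin.zero , trans (n≤0⇒n≡0 (≤-trans (degree≤max G Fin.zero) (≤-reflexive max≡0)))
                                    (≡.sym max≡0)

minDegree-attained : ∀ {m} (G : Graph (suc m)) → ∃ λ v → degree G v ≡ minDegree G
minDegree-attained {m} G with foldr-attained (degree G) ⊓-sel (suc m) (allFin (suc m))
... | inj₂ attained = attained
... | inj₁ min≡n = Fin.zero , ≤-antisym
  (≤-trans (<⇒≤ (degree<n G Fin.zero)) (≤-reflexive (≡.sym min≡n)))
  (min≤degree G Fin.zero)

nbWeight : ∀ {n} → Graph n → (Fin n → ℕ) → Fin n → ℕ
nbWeight {n} H g v = ∑ (allFin n) (λ u → 𝟙 (adj H v u) * g u)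

zeroInd : ℕ → ℕ
zeroInd zero    = 1
zeroInd (suc _) = 0

label-count : ∀ x → 1 + 𝟙 (is2 x) ≤ zeroInd x + x
label-count 0                   = s≤s z≤n
label-count 1                   = s≤s z≤n
label-count 2                   = s≤s (s≤s z≤n)
label-count (suc (suc (suc x))) = s≤s z≤n

two≤label : ∀ b x → 2 * 𝟙 (b ∧ is2 x) ≤ 𝟙 b * x
two≤label false x                   = z≤n
two≤label true  0                   = z≤n
two≤label true  1                   = z≤n
two≤label true  2                   = ≤-refl
two≤label true  (suc (suc (suc x))) = z≤n

module _ {n : ℕ} (H : Graph n) where

  twoNeighbours≤weight : ∀ g v → 2 * twoNeighbours H g v ≤ nbWeight H g v
  twoNeighbours≤weight g v = begin
    2 * twoNeighbours H g v
      ≡⟨ cong (2 *_) (length-filterᵇ (λ u → adj H v u ∧ is2 (g u)) Fₙ) ⟩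
    2 * ∑ Fₙ (λ u → 𝟙 (adj H v u ∧ is2 (g u)))
      ≡⟨ ≡.sym (∑-*ˡ 2 (λ u → 𝟙 (adj H v u ∧ is2 (g u))) Fₙ) ⟩
    ∑ Fₙ (λ u → 2 * 𝟙 (adj H v u ∧ is2 (g u)))
      ≤⟨ ∑-mono Fₙ (All.universal (λ u → two≤label (adj H v u) (g u)) Fₙ) ⟩
    nbWeight H g v ∎
    where
    open ≤-Reasoning
    Fₙ : List (Fin n)
    Fₙ = allFin n

  rkdf-weight : ∀ {k} f → IsRkDF k H f → ∀ v → 2 * k * zeroInd (lab f v) ≤ nbWeight H (lab f) v
  rkdf-weight {k} f rkdf v with lab f v in fv
  ... | zero = begin
    2 * k * 1                     ≡⟨ *-identityʳ (2 * k) ⟩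
    2 * k                         ≤⟨ *-monoʳ-≤ 2 (rkdf v fv) ⟩
    2 * twoNeighbours H (lab f) v ≤⟨ twoNeighbours≤weight (lab f) v ⟩
    nbWeight H (lab f) v          ∎
    where open ≤-Reasoning
  ... | suc _ rewrite *-zeroʳ (2 * k) = z≤n

module _ {n : ℕ} {k : ℕ} (H : Graph n) {fs : List (Labeling n)} where

  -- at most deg(v) functions of the family vanish at v: each one needs weight 2k on
  -- N(v), while the whole family places at most 2k on every vertex of N(v)
  zeros≤degree : 1 ≤ k → IsRkkFamily k H fs → ∀ v → ∑ fs (λ f → zeroInd (lab f v)) ≤ degree H v
  zeros≤degree (s≤s z≤n) (_ , rkdfs , capacity) v = *-cancelˡ-≤ (2 * k) (begin
    2 * k * ∑ fs (λ f → zeroInd (lab f v))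
      ≡⟨ ≡.sym (∑-*ˡ (2 * k) (λ f → zeroInd (lab f v)) fs) ⟩
    ∑ fs (λ f → 2 * k * zeroInd (lab f v))
      ≤⟨ ∑-mono fs (All.map (λ {f} rkdf → rkdf-weight H f rkdf v) rkdfs) ⟩
    ∑ fs (λ f → nbWeight H (lab f) v)
      ≡⟨ ∑-swap (λ f u → 𝟙 (adj H v u) * lab f u) fs Fₙ ⟩
    ∑ Fₙ (λ u → ∑ fs (λ f → 𝟙 (adj H v u) * lab f u))
      ≡⟨ ∑-cong Fₙ (λ u → ∑-*ˡ (𝟙 (adj H v u)) (λ f → lab f u) fs) ⟩
    ∑ Fₙ (λ u → 𝟙 (adj H v u) * ∑ fs (λ f → lab f u))
      ≤⟨ ∑-mono Fₙ (All.universal (λ u → *-monoʳ-≤ (𝟙 (adj H v u)) (capacity u)) Fₙ) ⟩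
    ∑ Fₙ (λ u → 𝟙 (adj H v u) * (2 * k))
      ≡⟨ ∑-cong Fₙ (λ u → *-comm (𝟙 (adj H v u)) (2 * k)) ⟩
    ∑ Fₙ (λ u → 2 * k * 𝟙 (adj H v u))
      ≡⟨ ∑-*ˡ (2 * k) (𝟙 ∘ adj H v) Fₙ ⟩
    2 * k * ∑ Fₙ (𝟙 ∘ adj H v)
      ≡⟨ cong (2 * k *_) (≡.sym (degree-∑ H v)) ⟩
    2 * k * degree H v ∎)
    where
    open ≤-Reasoning
    Fₙ : List (Fin n)
    Fₙ = allFin n

  family-bound : 1 ≤ k → IsRkkFamily k H fs → ∀ v →
    length fs + ∑ fs (λ f → 𝟙 (is2 (lab f v))) ≤ degree H v + 2 * k
  family-bound 1≤k fam@(_ , _ , capacity) v = begin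
    length fs + ∑ fs (λ f → 𝟙 (is2 (lab f v)))
      ≡⟨ cong (_+ ∑ fs (λ f → 𝟙 (is2 (lab f v)))) (≡.sym (∑-length fs)) ⟩
    ∑ fs (λ _ → 1) + ∑ fs (λ f → 𝟙 (is2 (lab f v)))
      ≡⟨ ≡.sym (∑-+ (λ _ → 1) (λ f → 𝟙 (is2 (lab f v))) fs) ⟩
    ∑ fs (λ f → 1 + 𝟙 (is2 (lab f v)))
      ≤⟨ ∑-mono fs (All.universal (λ f → label-count (lab f v)) fs) ⟩
    ∑ fs (λ f → zeroInd (lab f v) + lab f v)
      ≡⟨ ∑-+ (λ f → zeroInd (lab f v)) (λ f → lab f v) fs ⟩
    ∑ fs (λ f → zeroInd (lab f v)) + ∑ fs (λ f → lab f v)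
      ≤⟨ +-mono-≤ (zeros≤degree 1≤k fam v) (capacity v) ⟩
    degree H v + 2 * k ∎
    where open ≤-Reasoning

  family-size≤ : 1 ≤ k → IsRkkFamily k H fs → ∀ v → length fs ≤ degree H v + 2 * k
  family-size≤ 1≤k fam v = ≤-trans (m≤m+n (length fs) _) (family-bound 1≤k fam v)

𝟙≡0⇒false : ∀ {b} → 𝟙 b ≡ 0 → b ≡ false
𝟙≡0⇒false {false} _ = refl

no-twos⇒ones : ∀ {n k} (H : Graph n) (f : Labeling n) → 1 ≤ k → IsRkDF k H f →
  (∀ u → is2 (lab f u) ≡ false) → ∀ u → lab f u ≡ 1
no-twos⇒ones {n} H f 1≤k rkdf no-twos u with lab f u in fu
... | 0 = ⊥-elim (<⇒≱ 1≤k (≤-trans (rkdf u fu) (≤-reflexive no-two-neighbours)))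
  where
  no-two-neighbours : twoNeighbours H (lab f) u ≡ 0
  no-two-neighbours = trans (length-filterᵇ _ (allFin n)) (∑-zero⁺ (allFin n) (All.universal
    (λ w → cong 𝟙 (trans (cong (adj H u w ∧_) (no-twos w)) (∧-zeroʳ (adj H u w)))) (allFin n)))
... | 1 = refl
... | 2 with () ← trans (cong is2 (≡.sym fu)) (no-twos u)
... | suc (suc (suc _)) with s≤s (s≤s ()) ← ≤-trans (≤-reflexive (≡.sym fu)) (proj₂ f u)

distinct-agreeing≤1 : ∀ {n} (c : Fin n → ℕ) {fs : List (Labeling n)} → AllPairs Distinct fs →
  All (λ f → ∀ u → lab f u ≡ c u) fs → length fs ≤ 1
distinct-agreeing≤1 c {[]}          _                  _                  = z≤n
distinct-agreeing≤1 c {_ ∷ []}      _                  _                  = s≤s z≤n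
distinct-agreeing≤1 c {_ ∷ _ ∷ _} ((f≢g ∷ _) ∷ _) (f≡c ∷ g≡c ∷ _) =
  ⊥-elim (f≢g (λ u → trans (f≡c u) (≡.sym (g≡c u))))

-- in a D-regular graph a Roman (k,k)-dominating family has fewer than D + 2k members:
-- reaching the bound forces every function to avoid the label 2, hence to be constantly 1
regular-family-short : ∀ {n k D} (H : Graph n) {fs : List (Labeling n)} → 1 ≤ k →
  IsRkkFamily k H fs → (∀ v → degree H v ≡ D) → length fs < D + 2 * k
regular-family-short {n} {k} {D} H {fs} 1≤k fam@(distinct , rkdfs , _) regular = ≰⇒> reaching⇒⊥
  where
  reaching⇒⊥ : D + 2 * k ≤ length fs → ⊥
  reaching⇒⊥ long = <⇒≱ (≤-trans two≤bound long) (distinct-agreeing≤1 (λ _ → 1) distinct all-ones)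
    where
    open ≤-Reasoning
    no-twos : ∀ u → ∑ fs (λ f → 𝟙 (is2 (lab f u))) ≡ 0
    no-twos u = n≤0⇒n≡0 (+-cancelˡ-≤ (length fs) _ 0 (begin
      length fs + ∑ fs (λ f → 𝟙 (is2 (lab f u))) ≤⟨ family-bound H 1≤k fam u ⟩
      degree H u + 2 * k                         ≡⟨ cong (_+ 2 * k) (regular u) ⟩
      D + 2 * k                                  ≤⟨ long ⟩
      length fs                                  ≡⟨ ≡.sym (+-identityʳ (length fs)) ⟩
      length fs + 0                              ∎))
    all-ones : All (λ f → ∀ u → lab f u ≡ 1) fs
    all-ones = All.tabulate (λ {f} f∈fs → no-twos⇒ones H f 1≤k (All.lookup rkdfs f∈fs)
      (λ u → 𝟙≡0⇒false (All.lookup (∑-zero⁻ fs (no-twos u)) f∈fs)))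
    two≤bound : 2 ≤ D + 2 * k
    two≤bound = ≤-trans (*-monoʳ-≤ 2 1≤k) (m≤n+m (2 * k) D)

complement-regular : ∀ {n D} (G : Graph n) → (∀ v → degree G v ≡ D) →
  ∀ v w → degree (complement G) v ≡ degree (complement G) w
complement-regular {n} {D} G regular v w = +-cancelʳ-≡ D _ _ (+-cancelʳ-≡ 1 _ _ (begin
  degree Ḡ v + D + 1          ≡⟨ cong (λ d → degree Ḡ v + d + 1) (≡.sym (regular v)) ⟩
  degree Ḡ v + degree G v + 1 ≡⟨ complement-degree G v ⟩
  n                           ≡⟨ ≡.sym (complement-degree G w) ⟩
  degree Ḡ w + degree G w + 1 ≡⟨ cong (λ d → degree Ḡ w + d + 1) (regular w) ⟩
  degree Ḡ w + D + 1          ∎))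
  where
  open ≡-Reasoning
  Ḡ : Graph n
  Ḡ = complement G

-- Arithmetic closing the argument. Write Δ = s + δ and let b = deg_Ḡ of a vertex of
-- degree Δ, so b + Δ + 1 = n; the two family bounds add up to a₁ + a₂ + 1 + s ≤ n + 4k.
add-bounds : ∀ k {a₁ a₂ δ b n} s → a₁ ≤ δ + 2 * k → a₂ ≤ b + 2 * k →
  b + (s + δ) + 1 ≡ n → a₁ + a₂ + 1 + s ≤ n + 4 * k
add-bounds k {a₁} {a₂} {δ} {b} {n} s a₁≤ a₂≤ degrees = begin
  a₁ + a₂ + 1 + s                     ≤⟨ +-monoˡ-≤ s (+-monoˡ-≤ 1 (+-mono-≤ a₁≤ a₂≤)) ⟩
  (δ + 2 * k) + (b + 2 * k) + 1 + s   ≡⟨ regroup δ b s k ⟩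
  b + (s + δ) + 1 + 4 * k             ≡⟨ cong (_+ 4 * k) degrees ⟩
  n + 4 * k                           ∎
  where
  open ≤-Reasoning
  regroup : ∀ δ b s k → (δ + 2 * k) + (b + 2 * k) + 1 + s ≡ b + (s + δ) + 1 + 4 * k
  regroup = solve-∀

degree-sum-arith : ∀ k {a₁ a₂ δ b n} s → a₁ ≤ δ + 2 * k → a₂ ≤ b + 2 * k →
  b + (s + δ) + 1 ≡ n → (s ≡ 0 → a₁ < δ + 2 * k × a₂ < b + 2 * k) →
  (a₁ + a₂ ≤ n + 4 * k ∸ 2) × (a₁ + a₂ ≡ n + 4 * k ∸ 2 → s ≡ 1)
degree-sum-arith k {a₁} {a₂} {δ} {b} {n} zero _ _ degrees strict =
  <⇒≤ below , λ tight → ⊥-elim (<⇒≢ below tight)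
  where
  below : a₁ + a₂ < n + 4 * k ∸ 2
  below with a₁< , a₂< ← strict refl = m+n≤o⇒m≤o∸n (suc (a₁ + a₂))
    (≤-trans (≤-reflexive (regroup a₁ a₂)) (add-bounds k {δ = δ} {b} 0 a₁< a₂< degrees))
    where
    regroup : ∀ a₁ a₂ → suc (a₁ + a₂) + 2 ≡ suc a₁ + suc a₂ + 1 + 0
    regroup = solve-∀
degree-sum-arith k {a₁} {a₂} {n = n} (suc t) a₁≤ a₂≤ degrees _ =
  m+n≤o⇒m≤o∸n (a₁ + a₂) sum+2≤N , tight⇒t≡0
  where
  N : ℕ
  N = n + 4 * k
  regroup : ∀ x t → x + 2 + t ≡ x + 1 + suc t
  regroup = solve-∀
  sum+2+t≤N : a₁ + a₂ + 2 + t ≤ N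
  sum+2+t≤N = ≤-trans (≤-reflexive (regroup (a₁ + a₂) t)) (add-bounds k (suc t) a₁≤ a₂≤ degrees)
  sum+2≤N : a₁ + a₂ + 2 ≤ N
  sum+2≤N = ≤-trans (m≤m+n (a₁ + a₂ + 2) t) sum+2+t≤N
  tight⇒t≡0 : a₁ + a₂ ≡ N ∸ 2 → suc t ≡ 1
  tight⇒t≡0 tight = cong suc (n≤0⇒n≡0 (+-cancelˡ-≤ (a₁ + a₂ + 2) t 0 (begin
    a₁ + a₂ + 2 + t     ≤⟨ sum+2+t≤N ⟩
    N                   ≡⟨ ≡.sym (m∸n+n≡m (≤-trans (m≤n+m 2 (a₁ + a₂)) sum+2≤N)) ⟩
    N ∸ 2 + 2           ≡⟨ cong (_+ 2) (≡.sym tight) ⟩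
    a₁ + a₂ + 2         ≡⟨ ≡.sym (+-identityʳ _) ⟩
    a₁ + a₂ + 2 + 0     ∎)))
    where open ≤-Reasoning

theorem7 : (k n : ℕ) → 1 ≤ k → 1 ≤ n → (G : Graph n) → (d₁ d₂ : ℕ) →
    IsRomanKKDomaticNumber k G d₁ →
    IsRomanKKDomaticNumber k (complement G) d₂ →
    (d₁ + d₂ ≤ n + 4 * k ∸ 2) ×
    (d₁ + d₂ ≡ n + 4 * k ∸ 2 → maxDegree G ∸ minDegree G ≡ 1)
theorem7 k (suc m) 1≤k _ G _ _ ((fs₁ , fam₁ , refl) , _) ((fs₂ , fam₂ , refl) , _) =
  degree-sum-arith k {δ = δ} {degree Ḡ vₘₐₓ} (Δ ∸ δ) d₁≤ d₂≤ degrees regular⇒strict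
  where
  Ḡ : Graph (suc m)
  Ḡ = complement G
  δ Δ : ℕ
  δ = minDegree G
  Δ = maxDegree G
  vₘᵢₙ vₘₐₓ : Fin (suc m)
  vₘᵢₙ = proj₁ (minDegree-attained G)
  vₘₐₓ = proj₁ (maxDegree-attained G)
  δ≤Δ : δ ≤ Δ
  δ≤Δ = ≤-trans (min≤degree G vₘᵢₙ) (degree≤max G vₘᵢₙ)
  d₁≤ : length fs₁ ≤ δ + 2 * k
  d₁≤ = subst (λ d → length fs₁ ≤ d + 2 * k) (proj₂ (minDegree-attained G))
              (family-size≤ G 1≤k fam₁ vₘᵢₙ)
  d₂≤ : length fs₂ ≤ degree Ḡ vₘₐₓ + 2 * k
  d₂≤ = family-size≤ Ḡ 1≤k fam₂ vₘₐₓ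
  degrees : degree Ḡ vₘₐₓ + (Δ ∸ δ + δ) + 1 ≡ suc m
  degrees = trans (cong (λ d → degree Ḡ vₘₐₓ + d + 1)
    (trans (m∸n+n≡m δ≤Δ) (≡.sym (proj₂ (maxDegree-attained G))))) (complement-degree G vₘₐₓ)
  regular⇒strict : Δ ∸ δ ≡ 0 → length fs₁ < δ + 2 * k × length fs₂ < degree Ḡ vₘₐₓ + 2 * k
  regular⇒strict s≡0 = regular-family-short G 1≤k fam₁ G-regular
                     , regular-family-short Ḡ 1≤k fam₂ (λ v → complement-regular G G-regular v vₘₐₓ)
    where
    G-regular : ∀ v → degree G v ≡ δ
    G-regular v = ≤-antisym (≤-trans (degree≤max G v) (m∸n≡0⇒m≤n s≡0)) (min≤degree G v)
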